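{- Let $G=(S,A,\downarrow,\to)$ be a labeled transition system, $B\subseteq A$, and let $(\mathcal P_1,\sqsubseteq_1)$ and $(\mathcal P_2,\sqsubseteq_2)$ be partition-relation pairs over $G$ that are stable with respect to $\downarrow$, $\to$ and $B$. Then there exists a partition-relation pair $(\mathcal P_3,\sqsubseteq_3)$ over $G$ that is stable with respect to $\downarrow$, $\to$ and $B$, such that $(\mathcal P_1,\sqsubseteq_1)\lhd(\mathcal P_3,\sqsubseteq_3)$ and $(\mathcal P_2,\sqsubseteq_2)\lhd(\mathcal P_3,\sqsubseteq_3)$.
   Context: A labeled transition system $G=(S,A,\downarrow,\to)$ has state set $S$, action set $A$, termination predicate $\downarrow\subseteq S$ (write $p\downarrow$) and transition relation $\to\subseteq S\times A\times S$ (write $p\xrightarrow{a}q$). A partition-relation pair is $(\mathcal P,\sqsubseteq)$ with $\mathcal P$ a partition of $S$ and $\sqsubseteq\subseteq\mathcal P\times\mathcal P$ a partial order. $(\mathcal P,\sqsubseteq)\lhd(\mathcal P',\sqsubseteq')$ iff for all $P,Q\in\mathcal P$ with $P\sqsubseteq Q$ there exist $P',Q'\in\mathcal P'$ with $P\subseteq P'$, $Q\subseteq Q'$, $P'\sqsubseteq'Q'$. For a class $P$ write $P\downarrow$ if all its states terminate and $P\not\downarrow$ if none does. For $P,X\subseteq S$: $P\xrightarrow{a}_\exists X$ means some $p\in P$ has $p\xrightarrow{a}x$ with $x\in X$; $P\xrightarrow{a}_\forall X$ means every $p\in P$ has some $x\in X$ with $p\xrightarrow{a}x$. For $P\in\mathcal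 P$, $\mathrm{lb}(P)=\bigcup\{Q\in\mathcal P\mid Q\sqsubseteq P\}$, $\mathrm{bb}(P)=\bigcup\{Q\in\mathcal P\mid P\sqsubseteq Q\}$. $(\mathcal P,\sqsubseteq)$ is stable (w.r.t. $\downarrow,\to,B$) if: (a) every $P\in\mathcal P$ has $P\downarrow$ or $P\not\downarrow$; (b) if $P\sqsubseteq Q$ and $P\downarrow$ then $Q\downarrow$; (c) for all $P,Q,R\in\mathcal P$, $a\in A$: if $P\sqsubseteq Q$ and $P\xrightarrow{a}_\exists R$ then $Q\xrightarrow{a}_\forall\mathrm{bb}(R)$; (d) for all $P,Q,R\in\mathcal P$, $b\in B$: if $P\sqsubseteq Q$ and $Q\xrightarrow{b}_\exists R$ then $P\xrightarrow{b}_\forall\mathrm{lb}(R)$. -}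

module Defs where

open import Data.Product using (Σ; ∃; _×_; _,_)
open import Data.Sum using (_⊎_)
open import Relation.Nullary using (¬_)

record LTS : Set₁ where
  field
    S     : Set
    A     : Set
    term  : S → Set
    trans : S → A → S → Set

-- The partition 𝒫 is represented by its equivalence relation _~_
-- (blocks = equivalence classes; a block is referred to via any
-- representative).  The partial order ⊑ on blocks is represented by a
-- relation on representatives that respects _~_; antisymmetry is up to
-- _~_ (i.e. equality of blocks).
record PRPair (S : Set) : Set₁ where
  field
    _~_       : S → S → Set
    ~-refl    : ∀ {p} → p ~ p
    ~-sym     : ∀ {p q} → p ~ q → q ~ p
    ~-trans   : ∀ {p q r} → p ~ q → q ~ r → p ~ r
    _⊑_       : S → S → Set
    ⊑-resp    : ∀ {p p' q q'} → p ~ p' → q ~ q' → p ⊑ q → p' ⊑ q'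
    ⊑-refl    : ∀ {p} → p ⊑ p
    ⊑-trans   : ∀ {p q r} → p ⊑ q → q ⊑ r → p ⊑ r
    ⊑-antisym : ∀ {p q} → p ⊑ q → q ⊑ p → p ~ q

module _ {S : Set} (π : PRPair S) where
  open PRPair π

  InBlock : S → S → Set
  InBlock p x = x ~ p

  -- lb([r]) = ⋃ { Q | Q ⊑ [r] }  and  bb([r]) = ⋃ { Q | [r] ⊑ Q }
  InLb : S → S → Set
  InLb r x = x ⊑ r

  InBb : S → S → Set
  InBb r x = r ⊑ x

_⊲_ : {S : Set} → PRPair S → PRPair S → Set
_⊲_ {S} π π' =
  ∀ p q → p ⊑ q →
    Σ S λ p' → Σ S λ q' →
      (∀ x → InBlock π p x → InBlock π' p' x) ×
      (∀ x → InBlock π q x → InBlock π' q' x) ×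
      (p' ⊑' q')
  where
    open PRPair π
    open PRPair π' using () renaming (_⊑_ to _⊑'_)

module _ (G : LTS) where
  open LTS G

  AllTerm : PRPair S → S → Set
  AllTerm π p = ∀ x → InBlock π p x → term x

  NoneTerm : PRPair S → S → Set
  NoneTerm π p = ∀ x → InBlock π p x → ¬ term x

  StepExists : (S → Set) → A → (S → Set) → Set
  StepExists P a X = Σ S λ p → Σ S λ x → P p × X x × trans p a x

  StepForall : (S → Set) → A → (S → Set) → Set
  StepForall P a X = ∀ p → P p → Σ S λ x → X x × trans p a x

  record Stable (B : A → Set) (π : PRPair S) : Set where
    open PRPair π
    field
      stab-a : ∀ p → AllTerm π p ⊎ NoneTerm π p
      stab-b : ∀ p q → p ⊑ q → AllTerm π p → AllTerm π q
      stab-c : ∀ p q r a → p ⊑ q →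
                 StepExists (InBlock π p) a (InBlock π r) →
                 StepForall (InBlock π q) a (InBb π r)
      stab-d : ∀ p q r b → B b → p ⊑ q →
                 StepExists (InBlock π q) b (InBlock π r) →
                 StepForall (InBlock π p) b (InLb π r)

-- The order of a stable pair is a simulation that also preserves termination
-- and, for actions in B, is simulated backwards.  These properties survive
-- unions and reflexive-transitive closure, so ⊑₃ := (⊑₁ ∪ ⊑₂)* has them too;
-- taking its symmetric interior as the partition turns this preorder into a
-- stable partition-relation pair that both given pairs refine into.
module Submission where

open import Defs
open import Data.Product using (Σ; ∃; _×_; _,_; map₁; map₂)
open import Data.Sum using (_⊎_; inj₁; inj₂)
open import Function using (flip; id; _∘_)
open import Level using (0ℓ)
open import Relation.Binary.Bundles using (Poset)
open import Relation.Binary.Core using (Rel; _⇒_)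
open import Relation.Binary.Definitions using (Reflexive; Transitive; _Respects_)
open import Relation.Binary.Construct.Union as Union using (_∪_)
open import Relation.Binary.Construct.Closure.ReflexiveTransitive
  using (Star; ε; _◅_; _◅◅_; return; fold; reverse)
open import Relation.Binary.Construct.Interior.Symmetric as SymInterior
  using (SymInterior; _,_; lhs≤rhs; rhs≤lhs)
open import Relation.Nullary using (yes; no; contradiction)
open import Relation.Unary using (Decidable)

poset⇒PRPair : (P : Poset 0ℓ 0ℓ 0ℓ) → PRPair (Poset.Carrier P)
poset⇒PRPair P = record
  { _~_       = _≈_
  ; ~-refl    = Eq.refl
  ; ~-sym     = Eq.sym
  ; ~-trans   = Eq.trans
  ; _⊑_       = _≤_
  ; ⊑-resp    = λ p≈p′ q≈q′ → ≤-respˡ-≈ p≈p′ ∘ ≤-respʳ-≈ q≈q′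
  ; ⊑-refl    = refl
  ; ⊑-trans   = trans
  ; ⊑-antisym = antisym
  }
  where open Poset P

module _ {S : Set} {R : Rel S 0ℓ} (R-refl : Reflexive R) (R-trans : Transitive R) where

  preorder⇒PRPair : PRPair S
  preorder⇒PRPair = poset⇒PRPair (SymInterior.poset {R = R} R-refl R-trans)

  ⊲-preorder⇒PRPair : (π : PRPair S) → PRPair._⊑_ π ⇒ R → π ⊲ preorder⇒PRPair
  ⊲-preorder⇒PRPair π ⊑⇒R p q p⊑q = p , q , block⊆ , block⊆ , ⊑⇒R p⊑q
    where
    open PRPair π

    ~⇒⊑ : ∀ {x y} → x ~ y → x ⊑ y
    ~⇒⊑ x~y = ⊑-resp ~-refl x~y ⊑-refl

    block⊆ : ∀ {r} x → x ~ r → SymInterior R x r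
    block⊆ x x~r = ⊑⇒R (~⇒⊑ x~r) , ⊑⇒R (~⇒⊑ (~-sym x~r))

module _ (G : LTS) where
  open LTS G

  Simulation : Rel S 0ℓ → A → Set
  Simulation R a =
    ∀ {p q p′} → R p q → trans p a p′ → ∃ λ q′ → R p′ q′ × trans q a q′

  module _ {R R′ : Rel S 0ℓ} {a : A} where

    simulation-⇔ : R ⇒ R′ → R′ ⇒ R → Simulation R a → Simulation R′ a
    simulation-⇔ R⇒R′ R′⇒R sim r′ = map₂ (map₁ R⇒R′) ∘ sim (R′⇒R r′)

    simulation-∪ : Simulation R a → Simulation R′ a → Simulation (R ∪ R′) a
    simulation-∪ sim sim′ (inj₁ r)  = map₂ (map₁ inj₁) ∘ sim r
    simulation-∪ sim sim′ (inj₂ r′) = map₂ (map₁ inj₂) ∘ sim′ r′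

  simulation-Star : ∀ {R a} → Simulation R a → Simulation (Star R) a
  simulation-Star sim ε        tr = _ , ε , tr
  simulation-Star sim (r ◅ rs) tr with sim r tr
  ... | _ , r′ , tr′ with simulation-Star sim rs tr′
  ... | q′ , rs′ , tr″ = q′ , r′ ◅ rs′ , tr″

  record StableRelation (B : A → Set) (R : Rel S 0ℓ) : Set where
    field
      term-respects : term Respects R
      forward       : ∀ a → Simulation R a
      backward      : ∀ {b} → B b → Simulation (flip R) b

  module _ {B : A → Set} where

    stableRelation-∪ : {R R′ : Rel S 0ℓ} →
                       StableRelation B R → StableRelation B R′ → StableRelation B (R ∪ R′)
    stableRelation-∪ {R} {R′} st st′ = record
      { term-respects = Union.respects {L = R} {R = R′} S.term-respects S′.term-respects
      ; forward       = λ a → simulation-∪ (S.forward a) (S′.forward a)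
      ; backward      = λ b∈B → simulation-∪ (S.backward b∈B) (S′.backward b∈B)
      }
      where
      module S  = StableRelation st
      module S′ = StableRelation st′

    stableRelation-Star : {R : Rel S 0ℓ} → StableRelation B R → StableRelation B (Star R)
    stableRelation-Star {R} st = record
      { term-respects =
          fold {T = R} (λ p q → term p → term q) (λ r k → k ∘ term-respects r) id
      ; forward       = λ a → simulation-Star (forward a)
      ; backward      = λ b∈B →
          simulation-⇔ (reverse id) (reverse id) (simulation-Star (backward b∈B))
      }
      where open StableRelation st

    module _ {π : PRPair S} (st : Stable G B π) where
      open PRPair π
      open Stable st

      term-decidable : Decidable term
      term-decidable p with stab-a p
      ... | inj₁ all  = yes (all p ~-refl)
      ... | inj₂ none = no (none p ~-refl)

      stable⇒stableRelation : StableRelation B _⊑_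
      stable⇒stableRelation = record
        { term-respects = term-respects
        ; forward       = λ a {p} {q} {p′} p⊑q tr →
            stab-c p q p′ a p⊑q (p , p′ , ~-refl , ~-refl , tr) q ~-refl
        ; backward      = λ {b} b∈B {p} {q} {p′} q⊑p tr →
            stab-d q p p′ b b∈B q⊑p (p , p′ , ~-refl , ~-refl , tr) q ~-refl
        }
        where
        term-respects : term Respects _⊑_
        term-respects {p} {q} p⊑q tp with stab-a p
        ... | inj₁ all  = stab-b p q p⊑q all q ~-refl
        ... | inj₂ none = contradiction tp (none p ~-refl)

    module _ {R : Rel S 0ℓ} (R-refl : Reflexive R) (R-trans : Transitive R) where

      -- Constructively, condition (a) for the new blocks needs termination to
      -- be decidable; any stable pair decides it (term-decidable).
      stable-preorder⇒PRPair : Decidable term → StableRelation B R →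
                               Stable G B (preorder⇒PRPair R-refl R-trans)
      stable-preorder⇒PRPair term? st = record
        { stab-a = stab-a
        ; stab-b = λ p q p≤q all x x≈q →
            term-respects (R-trans p≤q (rhs≤lhs x≈q)) (all p (R-refl , R-refl))
        ; stab-c = λ { p q r a p≤q (s , t , s≈p , t≈r , tr) y y≈q →
            map₂ (map₁ (R-trans (rhs≤lhs t≈r)))
              (forward a (R-trans (lhs≤rhs s≈p) (R-trans p≤q (rhs≤lhs y≈q))) tr) }
        ; stab-d = λ { p q r b b∈B p≤q (s , t , s≈q , t≈r , tr) y y≈p →
            map₂ (map₁ (λ x≤t → R-trans x≤t (lhs≤rhs t≈r)))
              (backward b∈B (R-trans (lhs≤rhs y≈p) (R-trans p≤q (rhs≤lhs s≈q))) tr) }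
        }
        where
        open StableRelation st
        π = preorder⇒PRPair R-refl R-trans

        stab-a : ∀ p → AllTerm G π p ⊎ NoneTerm G π p
        stab-a p with term? p
        ... | yes tp = inj₁ λ x x≈p → term-respects (rhs≤lhs x≈p) tp
        ... | no ¬tp = inj₂ λ x x≈p tx → ¬tp (term-respects (lhs≤rhs x≈p) tx)

theorem5 : (G : LTS) (B : LTS.A G → Set) (π₁ π₂ : PRPair (LTS.S G)) →
    Stable G B π₁ → Stable G B π₂ →
    Σ (PRPair (LTS.S G)) λ π₃ → Stable G B π₃ × (π₁ ⊲ π₃) × (π₂ ⊲ π₃)
theorem5 G B π₁ π₂ st₁ st₂ =
  preorder⇒PRPair ε _◅◅_
  , stable-preorder⇒PRPair G ε _◅◅_ (term-decidable G st₁)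
      (stableRelation-Star G (stableRelation-∪ G (stable⇒stableRelation G st₁)
                                                 (stable⇒stableRelation G st₂)))
  , ⊲-preorder⇒PRPair ε _◅◅_ π₁ (return ∘ inj₁)
  , ⊲-preorder⇒PRPair ε _◅◅_ π₂ (return ∘ inj₂)
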